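{- Let $G=(V,E)$ be a connected block graph with at least three vertices, and let $\mathcal B$ be its set of maximal cliques. Compute a partial coloring $c'$ of $V$ with colors black and white as follows: (1) color every vertex of degree $1$ in $G$ black; (2) repeat exhaustively: if some $B\in\mathcal B$ has exactly one uncolored vertex $v$ and all other vertices of $B$ have the same color, color $v$ with the opposite color. Let $C'$ be the set of vertices colored by this procedure (for any order of the choices in step (2)). Then for every spanning even tree $T$ of $G$ with admissible coloring $c$, we have $c(v)=c'(v)$ for all $v\in C'$.
   Context: All graphs are finite and simple. A block graph is a graph in which every biconnected component induces a clique; its maximal cliques are exactly its blocks. A leaf of a tree is a vertex of degree $1$. A tree is even if for every pair of distinct leaves, the number of edges of the unique path between them is even; a spanning even tree of $G$ is a spanning tree that is even. A tree $T$ is even if and only if it has a proper $2$-coloring with colors black and white in which all leaves are black; for an even tree this coloring is unique and is called the admissible coloring of $T$. -}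

module Defs where

open import Data.Bool using (Bool; true; false; not)
open import Data.Nat using (ℕ; zero; suc; _+_; _≤_)
open import Data.Nat.Divisibility using (_∣_)
open import Data.Fin using (Fin)
open import Data.List using (List; []; _∷_; length; filterᵇ; allFin)
open import Data.List.Relation.Unary.All using (All)
open import Data.List.Relation.Unary.Unique.Propositional using (Unique)
open import Data.Maybe using (Maybe; just; nothing)
open import Data.Product using (Σ; ∃; _×_; _,_)
open import Relation.Binary.PropositionalEquality using (_≡_; _≢_)
open import Relation.Nullary using (¬_)

Graph : ℕ → Set
Graph n = Fin n → Fin n → Bool

VSet : ℕ → Set
VSet n = Fin n → Bool

module _ {n : ℕ} where

  SimpleGraph : Graph n → Set
  SimpleGraph g = (∀ u v → g u v ≡ g v u) × (∀ v → g v v ≡ false)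

  deg : Graph n → Fin n → ℕ
  deg g v = length (filterᵇ (g v) (allFin n))

  data Walk (g : Graph n) : Fin n → Fin n → Set where
    [_]  : (v : Fin n) → Walk g v v
    _∷⟨_⟩_ : (u : Fin n) {v w : Fin n} → g u v ≡ true → Walk g v w → Walk g u w

  verts : ∀ {g u v} → Walk g u v → List (Fin n)
  verts [ v ] = v ∷ []
  verts (u ∷⟨ _ ⟩ p) = u ∷ verts p

  len : ∀ {g u v} → Walk g u v → ℕ
  len [ v ] = zero
  len (u ∷⟨ _ ⟩ p) = suc (len p)

  IsPath : ∀ {g u v} → Walk g u v → Set
  IsPath p = Unique (verts p)

  _∈ₛ_ : Fin n → VSet n → Set
  v ∈ₛ S = S v ≡ true

  _⊆ₛ_ : VSet n → VSet n → Set
  S ⊆ₛ S' = ∀ v → v ∈ₛ S → v ∈ₛ S'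

  ConnectedIn : Graph n → VSet n → Set
  ConnectedIn g S = ∀ u v → u ∈ₛ S → v ∈ₛ S →
    Σ (Walk g u v) λ p → All (_∈ₛ S) (verts p)

  Full : VSet n
  Full _ = true

  Connected : Graph n → Set
  Connected g = ConnectedIn g Full

  remove : (x : Fin n) → VSet n → VSet n
  remove x S v = S v Data.Bool.∧ not (isEq x v)
    where
    open import Data.Fin using (_≟_)
    open import Relation.Nullary using (does)
    isEq : Fin n → Fin n → Bool
    isEq a b = does (a ≟ b)

  Nonseparable : Graph n → VSet n → Set
  Nonseparable g S = ConnectedIn g S × (∀ x → x ∈ₛ S → ConnectedIn g (remove x S))

  IsBlock : Graph n → VSet n → Set
  IsBlock g S = (∃ λ v → v ∈ₛ S) × Nonseparable g S ×
    (∀ S' → Nonseparable g S' → S ⊆ₛ S' → S' ⊆ₛ S)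

  IsClique : Graph n → VSet n → Set
  IsClique g S = ∀ u v → u ∈ₛ S → v ∈ₛ S → u ≢ v → g u v ≡ true

  IsMaximalClique : Graph n → VSet n → Set
  IsMaximalClique g S = IsClique g S × (∀ S' → IsClique g S' → S ⊆ₛ S' → S' ⊆ₛ S)

  BlockGraph : Graph n → Set
  BlockGraph g = ∀ S → IsBlock g S → IsClique g S

  Acyclic : Graph n → Set
  Acyclic g = ∀ u v (p : Walk g u v) → IsPath p → 2 ≤ len p → g v u ≡ true → Data.Empty.⊥
    where import Data.Empty

  SpanningTree : Graph n → Graph n → Set
  SpanningTree g t = SimpleGraph t × (∀ u v → t u v ≡ true → g u v ≡ true)
                     × Connected t × Acyclic t

  IsLeaf : Graph n → Fin n → Set
  IsLeaf t v = deg t v ≡ 1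

  EvenTree : Graph n → Set
  EvenTree t = ∀ u v → IsLeaf t u → IsLeaf t v → u ≢ v →
    (p : Walk t u v) → IsPath p → 2 ∣ len p

  -- colors: true = black, false = white
  -- admissible coloring: proper 2-coloring with all leaves black
  Admissible : Graph n → (Fin n → Bool) → Set
  Admissible t c = (∀ u v → t u v ≡ true → c u ≢ c v) × (∀ v → IsLeaf t v → c v ≡ true)

  PColoring : Set
  PColoring = Fin n → Maybe Bool

  initColoring : Graph n → PColoring
  initColoring g v with deg g v Data.Nat.≡ᵇ 1
  ... | true = just true
  ... | false = nothing

  data Step (g : Graph n) (c : PColoring) (c' : PColoring) : Set where
    step : (B : VSet n) → IsMaximalClique g B → (v : Fin n) → v ∈ₛ B →
           c v ≡ nothing → (col : Bool) →
           (∀ u → u ∈ₛ B → u ≢ v → c u ≡ just col) →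
           c' v ≡ just (not col) → (∀ u → u ≢ v → c' u ≡ c u) →
           Step g c c'

  Terminal : Graph n → PColoring → Set
  Terminal g c = ∀ c' → ¬ Step g c c'

-- Let c be the admissible colouring of the spanning tree T. Degree-1 vertices of G are leaves of T,
-- hence black under c. For the propagation step, let B be a maximal clique whose vertices other
-- than v all have colour col, and suppose c v = col as well. B has a second vertex u; the tree path
-- from v to u together with B has no cut vertex, so it lies inside one block, which is a clique of
-- the block graph G and, by maximality, equal to B. Then the successor of v on that path is a tree
-- neighbour of v in B of the same colour, contradicting properness. So c v = not col, and c agrees
-- with every colour assigned along the run.

module Submission where

open import Defs
open import Data.Bool using (Bool; true; false; not; _∨_; T)
open import Data.Bool.Properties using (¬-not; ∨-zeroʳ) renaming (_≟_ to _≟ᵇ_)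
open import Data.Nat using (ℕ; zero; suc; _≤_; _<_; _∸_; z≤n; s≤s; _≡ᵇ_)
open import Data.Nat.Properties using (≤-trans; ≤-antisym; ≤-reflexive; <⇒≤; m≤n⇒m≤1+n; m<n⇒m<1+n; ∸-monoʳ-<; ≡ᵇ⇒≡)
open import Data.Nat.Induction using (<-wellFounded)
open import Data.Fin using (Fin; zero; suc; _≟_)
open import Data.Maybe using (just)
open import Data.Maybe.Properties using (just-injective)
open import Data.Product using (Σ; ∃; _×_; _,_; proj₁; proj₂)
open import Data.Sum using (_⊎_; inj₁; inj₂; [_,_]′; map₂)
open import Data.List using (List; []; _∷_; length; filterᵇ; allFin)
open import Data.List.Properties using (length-filter; length-tabulate)
open import Data.List.Membership.Propositional using (_∈_; _∉_)
open import Data.List.Membership.Propositional.Properties using (∈-allFin)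
open import Data.List.Relation.Binary.Subset.Propositional using (_⊆_)
open import Data.List.Relation.Unary.Any using (here; there; any?)
open import Data.List.Relation.Unary.All as All using (All; []; _∷_)
open import Data.List.Relation.Unary.All.Properties using (¬Any⇒All¬)
open import Data.List.Relation.Unary.AllPairs using ([]; _∷_)
open import Data.List.Relation.Unary.Unique.Propositional using (Unique)
open import Induction.WellFounded using (Acc; acc)
open import Relation.Binary.PropositionalEquality using (_≡_; _≢_; refl; sym; trans; subst; cong)
open import Relation.Binary.Construct.Closure.ReflexiveTransitive using (Star; fold)
open import Relation.Nullary using (¬_; yes; no; does)
open import Relation.Nullary.Decidable using (dec-true; dec-false; decidable-stable; ¬¬-excluded-middle)
open import Relation.Nullary.Negation using (contradiction)
open import Function using (_∘_; id)

module _ {n : ℕ} where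

  size : VSet n → ℕ
  size S = length (filterᵇ S (allFin n))

  _∪_ : VSet n → VSet n → VSet n
  (S ∪ S') z = S z ∨ S' z

  ⟦_⟧ : List (Fin n) → VSet n
  ⟦ xs ⟧ z = does (any? (z ≟_) xs)

  ∈-∪⁺ˡ : ∀ (S S' : VSet n) {z} → z ∈ₛ S → z ∈ₛ (S ∪ S')
  ∈-∪⁺ˡ S S' z∈S rewrite z∈S = refl

  ∈-∪⁺ʳ : ∀ (S S' : VSet n) {z} → z ∈ₛ S' → z ∈ₛ (S ∪ S')
  ∈-∪⁺ʳ S S' {z} z∈S' rewrite z∈S' = ∨-zeroʳ (S z)

  ∈-∪⁻ : ∀ (S S' : VSet n) {z} → z ∈ₛ (S ∪ S') → z ∈ₛ S ⊎ z ∈ₛ S'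
  ∈-∪⁻ S S' {z} z∈S∪S' with S z | S' z
  ... | true  | _    = inj₁ refl
  ... | false | true = inj₂ refl

  ∈-⟦⟧⁺ : ∀ {xs z} → z ∈ xs → z ∈ₛ ⟦ xs ⟧
  ∈-⟦⟧⁺ {xs} {z} = dec-true (any? (z ≟_) xs)

  ∈-⟦⟧⁻ : ∀ (xs : List (Fin n)) {z} → z ∈ₛ ⟦ xs ⟧ → z ∈ xs
  ∈-⟦⟧⁻ xs {z} z∈xs with any? (z ≟_) xs
  ... | yes z∈xs′ = z∈xs′

  ∈-remove⁺ : ∀ (x : Fin n) (S : VSet n) {z} → z ∈ₛ S → x ≢ z → z ∈ₛ remove x S
  ∈-remove⁺ x S {z} z∈S x≢z rewrite z∈S | dec-false (x ≟ z) x≢z = refl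

  ∈-remove⁻ : ∀ (x : Fin n) (S : VSet n) {z} → z ∈ₛ remove x S → z ∈ₛ S × x ≢ z
  ∈-remove⁻ x S {z} z∈S-x with S z | x ≟ z
  ... | true | no x≢z = refl , x≢z

length-filterᵇ-mono : ∀ {A : Set} {p q : A → Bool} → (∀ x → p x ≡ true → q x ≡ true) →
                      ∀ xs → length (filterᵇ p xs) ≤ length (filterᵇ q xs)
length-filterᵇ-mono p⇒q [] = z≤n
length-filterᵇ-mono {p = p} {q} p⇒q (x ∷ xs) with p x in px | q x in qx
... | true  | true  = s≤s (length-filterᵇ-mono p⇒q xs)
... | true  | false = contradiction (trans (sym (p⇒q x px)) qx) λ ()
... | false | true  = m≤n⇒m≤1+n (length-filterᵇ-mono p⇒q xs)
... | false | false = length-filterᵇ-mono p⇒q xs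

length-filterᵇ-mono-< : ∀ {A : Set} {p q : A → Bool} → (∀ x → p x ≡ true → q x ≡ true) →
                        ∀ {x xs} → x ∈ xs → q x ≡ true → p x ≡ false →
                        length (filterᵇ p xs) < length (filterᵇ q xs)
length-filterᵇ-mono-< p⇒q {xs = _ ∷ xs} (here refl) qx px rewrite qx | px =
  s≤s (length-filterᵇ-mono p⇒q xs)
length-filterᵇ-mono-< {p = p} {q} p⇒q {xs = y ∷ xs} (there x∈xs) qx px with p y in py | q y in qy
... | true  | true  = s≤s (length-filterᵇ-mono-< p⇒q x∈xs qx px)
... | true  | false = contradiction (trans (sym (p⇒q y py)) qy) λ ()
... | false | true  = m<n⇒m<1+n (length-filterᵇ-mono-< p⇒q x∈xs qx px)
... | false | false = length-filterᵇ-mono-< p⇒q x∈xs qx px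

module _ {n : ℕ} where

  size≤n : (S : VSet n) → size S ≤ n
  size≤n S = subst (size S ≤_) (length-tabulate id) (length-filter _ (allFin n))

  size-mono : ∀ {S S' : VSet n} → S ⊆ₛ S' → size S ≤ size S'
  size-mono S⊆S' = length-filterᵇ-mono S⊆S' (allFin n)

  size-mono-< : ∀ {S S' : VSet n} → S ⊆ₛ S' → ∀ {v} → v ∈ₛ S' → S v ≡ false → size S < size S'
  size-mono-< S⊆S' {v} = length-filterᵇ-mono-< S⊆S' (∈-allFin v)

  ∈⇒0<size : ∀ (S : VSet n) {v} → v ∈ₛ S → 0 < size S
  ∈⇒0<size S v∈S = ≤-trans (s≤s z≤n) (size-mono-< {S = λ _ → false} {S} (λ _ ()) v∈S refl)

module _ {n : ℕ} {g : Graph n} where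

  start∈verts : ∀ {a b} (p : Walk g a b) → a ∈ verts p
  start∈verts [ a ]        = here refl
  start∈verts (a ∷⟨ _ ⟩ p) = here refl

  end∈verts : ∀ {a b} (p : Walk g a b) → b ∈ verts p
  end∈verts [ b ]        = here refl
  end∈verts (a ∷⟨ _ ⟩ p) = there (end∈verts p)

  successor : ∀ {a b} (p : Walk g a b) → a ≢ b → ∃ λ s → g a s ≡ true × s ∈ verts p
  successor [ a ]              a≢a = contradiction refl a≢a
  successor (_∷⟨_⟩_ a {s} e p) _   = s , e , there (start∈verts p)

  _++ʷ_ : ∀ {a b c} → Walk g a b → Walk g b c → Walk g a c
  [ a ]        ++ʷ q = q
  (a ∷⟨ e ⟩ p) ++ʷ q = a ∷⟨ e ⟩ (p ++ʷ q)

  ∈-++ʷ⁻ : ∀ {a b c z} (p : Walk g a b) (q : Walk g b c) →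
           z ∈ verts (p ++ʷ q) → z ∈ verts p ⊎ z ∈ verts q
  ∈-++ʷ⁻ [ a ]        q z∈q         = inj₂ z∈q
  ∈-++ʷ⁻ (a ∷⟨ e ⟩ p) q (here z≡a)  = inj₁ (here z≡a)
  ∈-++ʷ⁻ (a ∷⟨ e ⟩ p) q (there z∈) with ∈-++ʷ⁻ p q z∈
  ... | inj₁ z∈p = inj₁ (there z∈p)
  ... | inj₂ z∈q = inj₂ z∈q

  prefix : ∀ {a b x} (p : Walk g a b) → x ∈ verts p → Σ (Walk g a x) λ r → verts r ⊆ verts p
  prefix [ a ]        (here refl) = [ a ] , id
  prefix (a ∷⟨ e ⟩ p) (here refl) = [ a ] , λ { (here refl) → here refl }
  prefix (a ∷⟨ e ⟩ p) (there x∈p) with prefix p x∈p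
  ... | r , r⊆p = a ∷⟨ e ⟩ r , λ { (here refl) → here refl ; (there z∈r) → there (r⊆p z∈r) }

  suffix : ∀ {a b x} (p : Walk g a b) → x ∈ verts p →
           Σ (Walk g x b) λ r → verts r ⊆ verts p × (IsPath p → IsPath r)
  suffix [ a ]        (here refl) = [ a ] , id , id
  suffix (a ∷⟨ e ⟩ p) (here refl) = a ∷⟨ e ⟩ p , id , id
  suffix (a ∷⟨ e ⟩ p) (there x∈p) with suffix p x∈p
  ... | r , r⊆p , path = r , there ∘ r⊆p , λ { (_ ∷ p-path) → path p-path }

  toPath : ∀ {a b} → Walk g a b → Σ (Walk g a b) IsPath
  toPath [ a ] = [ a ] , [] ∷ []
  toPath (a ∷⟨ e ⟩ p) with toPath p
  ... | q , q-path with any? (a ≟_) (verts q)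
  ...   | yes a∈q = let r , _ , path = suffix q a∈q in r , path q-path
  ...   | no  a∉q = a ∷⟨ e ⟩ q , ¬Any⇒All¬ (verts q) a∉q ∷ q-path

  -- x occurs at most once on a path, so it misses the part before y or the part after y.
  prefix⊎suffix-avoiding : ∀ {a b x y} (p : Walk g a b) → IsPath p → y ∈ verts p → x ≢ y →
    (Σ (Walk g a y) λ r → verts r ⊆ verts p × x ∉ verts r) ⊎
    (Σ (Walk g y b) λ r → verts r ⊆ verts p × x ∉ verts r)
  prefix⊎suffix-avoiding [ a ] _ (here refl) x≢a =
    inj₁ ([ a ] , id , λ { (here x≡a) → x≢a x≡a })
  prefix⊎suffix-avoiding (a ∷⟨ e ⟩ p) _ (here refl) x≢a =
    inj₁ ([ a ] , (λ { (here refl) → here refl }) , λ { (here x≡a) → x≢a x≡a })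
  prefix⊎suffix-avoiding {x = x} (a ∷⟨ e ⟩ p) (a∉p ∷ p-path) (there y∈p) x≢y with x ≟ a
  ... | yes refl = let r , r⊆p , _ = suffix p y∈p in
    inj₂ (r , there ∘ r⊆p , λ x∈r → All.lookup a∉p (r⊆p x∈r) refl)
  ... | no x≢a with prefix⊎suffix-avoiding p p-path y∈p x≢y
  ...   | inj₁ (r , r⊆p , x∉r) = inj₁ (a ∷⟨ e ⟩ r ,
            (λ { (here refl) → here refl ; (there z∈r) → there (r⊆p z∈r) }) ,
            λ { (here x≡a) → x≢a x≡a ; (there x∈r) → x∉r x∈r })
  ...   | inj₂ (r , r⊆p , x∉r) = inj₂ (r , there ∘ r⊆p , x∉r)

  module _ (g-sym : ∀ u v → g u v ≡ g v u) where

    reverse : ∀ {a b} → Walk g a b → Walk g b a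
    reverse [ a ]              = [ a ]
    reverse (_∷⟨_⟩_ a {s} e p) = reverse p ++ʷ (s ∷⟨ trans (g-sym s a) e ⟩ [ a ])

    verts-reverse : ∀ {a b} (p : Walk g a b) → verts (reverse p) ⊆ verts p
    verts-reverse [ a ] z∈ = z∈
    verts-reverse (_∷⟨_⟩_ a {s} e p) z∈ with ∈-++ʷ⁻ (reverse p) (s ∷⟨ trans (g-sym s a) e ⟩ [ a ]) z∈
    ... | inj₁ z∈p                = there (verts-reverse p z∈p)
    ... | inj₂ (here refl)        = there (start∈verts p)
    ... | inj₂ (there (here z≡a)) = here z≡a

mapʷ : ∀ {n} {G H : Graph n} → (∀ u v → G u v ≡ true → H u v ≡ true) →
       ∀ {a b} → Walk G a b → Walk H a b
mapʷ G⊆H [ a ]              = [ a ]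
mapʷ G⊆H (_∷⟨_⟩_ a {s} e p) = a ∷⟨ G⊆H a s e ⟩ mapʷ G⊆H p

verts-mapʷ : ∀ {n} {G H : Graph n} (G⊆H : ∀ u v → G u v ≡ true → H u v ≡ true) →
             ∀ {a b} (p : Walk G a b) → verts (mapʷ G⊆H p) ≡ verts p
verts-mapʷ G⊆H [ a ]        = refl
verts-mapʷ G⊆H (a ∷⟨ e ⟩ p) = cong (a ∷_) (verts-mapʷ G⊆H p)

module _ {n : ℕ} (g : Graph n) where

  WalkIn : VSet n → Fin n → Fin n → Set
  WalkIn X a b = Σ (Walk g a b) λ p → All (_∈ₛ X) (verts p)

  walkIn : ∀ {X a b} (p : Walk g a b) → (∀ {z} → z ∈ verts p → z ∈ₛ X) → WalkIn X a b
  walkIn p p⊆X = p , All.tabulate p⊆X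

  walkIn-trans : ∀ {X a b c} → WalkIn X a b → WalkIn X b c → WalkIn X a c
  walkIn-trans (p , p⊆X) (q , q⊆X) =
    walkIn (p ++ʷ q) ([ All.lookup p⊆X , All.lookup q⊆X ]′ ∘ ∈-++ʷ⁻ p q)

  walkIn-clique : ∀ {B X a b} → IsClique g B → a ∈ₛ B → b ∈ₛ B → a ∈ₛ X → b ∈ₛ X → WalkIn X a b
  walkIn-clique {a = a} {b} clique a∈B b∈B a∈X b∈X with a ≟ b
  ... | yes refl = [ a ] , a∈X ∷ []
  ... | no a≢b   = a ∷⟨ clique a b a∈B b∈B a≢b ⟩ [ b ] , a∈X ∷ b∈X ∷ []

  module _ (g-sym : ∀ u v → g u v ≡ g v u) where

    walkIn-sym : ∀ {X a b} → WalkIn X a b → WalkIn X b a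
    walkIn-sym (p , p⊆X) = walkIn (reverse g-sym p) (All.lookup p⊆X ∘ verts-reverse g-sym p)

    connectedIn-star : ∀ {X} h → h ∈ₛ X → (∀ y → y ∈ₛ X → WalkIn X y h) → ConnectedIn g X
    connectedIn-star h h∈X to-h u v u∈X v∈X = walkIn-trans (to-h u u∈X) (walkIn-sym (to-h v v∈X))

module CliqueWithPath {n : ℕ} {g : Graph n} (g-sym : ∀ u v → g u v ≡ g v u)
                      {B : VSet n} (clique : IsClique g B)
                      {v w : Fin n} (v∈B : v ∈ₛ B) (w∈B : w ∈ₛ B) (v≢w : v ≢ w)
                      (R : Walk g v w) (R-path : IsPath R) where

  S : VSet n
  S = B ∪ ⟦ verts R ⟧

  ∈S⁻ : ∀ {y} → y ∈ₛ S → y ∈ₛ B ⊎ y ∈ verts R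
  ∈S⁻ {y} y∈S = map₂ (∈-⟦⟧⁻ (verts R)) (∈-∪⁻ B ⟦ verts R ⟧ y∈S)

  ∈S⁺ˡ : ∀ {y} → y ∈ₛ B → y ∈ₛ S
  ∈S⁺ˡ = ∈-∪⁺ˡ B ⟦ verts R ⟧

  ∈S⁺ʳ : ∀ {y} → y ∈ verts R → y ∈ₛ S
  ∈S⁺ʳ = ∈-∪⁺ʳ B ⟦ verts R ⟧ ∘ ∈-⟦⟧⁺

  connected : ConnectedIn g S
  connected = connectedIn-star g g-sym v (∈S⁺ˡ v∈B) to-v
    where
    to-v : ∀ y → y ∈ₛ S → WalkIn g S y v
    to-v y y∈S with ∈S⁻ y∈S
    ... | inj₁ y∈B = walkIn-clique g clique y∈B v∈B y∈S (∈S⁺ˡ v∈B)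
    ... | inj₂ y∈R = let r , r⊆R = prefix R y∈R in
      walkIn-sym g g-sym (walkIn g r (∈S⁺ʳ ∘ r⊆R))

  -- Route every vertex to a vertex h ≠ x of B: along the clique, or along the part of R missing x,
  -- which ends in v or w.
  connected-remove-via : ∀ x {h} → h ∈ₛ B → x ≢ h → ConnectedIn g (remove x S)
  connected-remove-via x {h} h∈B x≢h = connectedIn-star g g-sym h (∈-remove⁺ x S (∈S⁺ˡ h∈B) x≢h) to-h
    where
    avoiding : ∀ {a b} (r : Walk g a b) → verts r ⊆ verts R → x ∉ verts r → WalkIn g (remove x S) a b
    avoiding r r⊆R x∉r = walkIn g r λ z∈r →
      ∈-remove⁺ x S (∈S⁺ʳ (r⊆R z∈r)) λ { refl → x∉r z∈r }

    clique-to-h : ∀ {b} → b ∈ₛ B → b ∈ₛ remove x S → WalkIn g (remove x S) b h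
    clique-to-h b∈B b∈X = walkIn-clique g clique b∈B h∈B b∈X (∈-remove⁺ x S (∈S⁺ˡ h∈B) x≢h)

    path-to-h : ∀ {y} → y ∈ verts R → x ≢ y → WalkIn g (remove x S) y h
    path-to-h y∈R x≢y with prefix⊎suffix-avoiding R R-path y∈R x≢y
    ... | inj₁ (r , r⊆R , x∉r) = let r-in = avoiding r r⊆R x∉r in
      walkIn-trans g (walkIn-sym g g-sym r-in) (clique-to-h v∈B (All.lookup (proj₂ r-in) (start∈verts r)))
    ... | inj₂ (r , r⊆R , x∉r) = let r-in = avoiding r r⊆R x∉r in
      walkIn-trans g r-in (clique-to-h w∈B (All.lookup (proj₂ r-in) (end∈verts r)))

    to-h : ∀ y → y ∈ₛ remove x S → WalkIn g (remove x S) y h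
    to-h y y∈X with ∈-remove⁻ x S y∈X
    ... | y∈S , x≢y = [ (λ y∈B → clique-to-h y∈B y∈X) , (λ y∈R → path-to-h y∈R x≢y) ]′ (∈S⁻ y∈S)

  connected-remove : ∀ x → ConnectedIn g (remove x S)
  connected-remove x with x ≟ v
  ... | yes refl = connected-remove-via x w∈B v≢w
  ... | no x≢v   = connected-remove-via x v∈B x≢v

  nonseparable : Nonseparable g S
  nonseparable = connected , λ x _ → connected-remove x

module _ {n : ℕ} (g : Graph n) where

  ProperNonseparableExtension : VSet n → Set
  ProperNonseparableExtension S =
    Σ (VSet n) λ S' → Nonseparable g S' × S ⊆ₛ S' × ∃ λ v → v ∈ₛ S' × S v ≡ false

  -- Enlarge S while a proper nonseparable extension exists (a classical case split, hence ¬ ¬);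
  -- n ∸ size S decreases each time.
  nonseparable⇒⊆block : ∀ S → Nonseparable g S → (∃ λ v → v ∈ₛ S) →
                         ¬ ¬ (∃ λ K → IsBlock g K × S ⊆ₛ K)
  nonseparable⇒⊆block S = grow S (<-wellFounded (n ∸ size S))
    where
    grow : ∀ S → Acc _<_ (n ∸ size S) → Nonseparable g S → (∃ λ v → v ∈ₛ S) →
           ¬ ¬ (∃ λ K → IsBlock g K × S ⊆ₛ K)
    grow S (acc smaller) S-ns S-ne noBlock = ¬¬-excluded-middle λ where
        (no noExtension) → noBlock (S , (S-ne , S-ns , maximal noExtension) , λ _ → id)
        (yes (S' , S'-ns , S⊆S' , v , v∈S' , v∉S)) →
          grow S' (smaller (∸-monoʳ-< (size-mono-< S⊆S' v∈S' v∉S) (size≤n S'))) S'-ns (v , v∈S')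
            λ (K , K-block , S'⊆K) → noBlock (K , K-block , λ z → S'⊆K z ∘ S⊆S' z)
      where
      maximal : ¬ ProperNonseparableExtension S → ∀ S' → Nonseparable g S' → S ⊆ₛ S' → S' ⊆ₛ S
      maximal noExtension S' S'-ns S⊆S' z z∈S' with S z in z∉S
      ... | true  = refl
      ... | false = contradiction (S' , S'-ns , S⊆S' , z , z∈S' , z∉S) noExtension

module _ {n : ℕ} {g : Graph n} (sg : SimpleGraph g) {B : VSet n} (maxClique : IsMaximalClique g B) where

  private
    g-sym = proj₁ sg
    clique = proj₁ maxClique
    maximal = proj₂ maxClique

  maximalClique-absorbs : ∀ {a} → (∀ u → u ∈ₛ B → u ≢ a → g u a ≡ true) → a ∈ₛ B
  maximalClique-absorbs {a} adjacent = maximal B+a extended (λ _ → ∈-∪⁺ˡ B ⟦ a ∷ [] ⟧) a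
                                              (∈-∪⁺ʳ B ⟦ a ∷ [] ⟧ (∈-⟦⟧⁺ {xs = a ∷ []} (here refl)))
    where
    B+a : VSet n
    B+a = B ∪ ⟦ a ∷ [] ⟧

    ∈B+a⁻ : ∀ {z} → z ∈ₛ B+a → z ∈ₛ B ⊎ z ≡ a
    ∈B+a⁻ {z} z∈ with ∈-∪⁻ B ⟦ a ∷ [] ⟧ z∈
    ... | inj₁ z∈B = inj₁ z∈B
    ... | inj₂ z∈a with ∈-⟦⟧⁻ (a ∷ []) z∈a
    ...   | here z≡a = inj₂ z≡a

    extended : IsClique g B+a
    extended x y x∈ y∈ x≢y with ∈B+a⁻ x∈ | ∈B+a⁻ y∈
    ... | inj₁ x∈B | inj₁ y∈B = clique x y x∈B y∈B x≢y
    ... | inj₁ x∈B | inj₂ refl = adjacent x x∈B x≢y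
    ... | inj₂ refl | inj₁ y∈B = trans (g-sym x y) (adjacent y y∈B (x≢y ∘ sym))
    ... | inj₂ refl | inj₂ refl = contradiction refl x≢y

  maximalClique-nontrivial : ∀ {v a} → v ∈ₛ B → g v a ≡ true → ¬ ¬ (∃ λ u → u ∈ₛ B × u ≢ v)
  maximalClique-nontrivial {v} {a} v∈B va none = none (a , a∈B , a≢v)
    where
    a∈B : a ∈ₛ B
    a∈B = maximalClique-absorbs λ u u∈B _ → adjacent-to-a u u∈B
      where
      adjacent-to-a : ∀ u → u ∈ₛ B → g u a ≡ true
      adjacent-to-a u u∈B with u ≟ v
      ... | yes refl = va
      ... | no u≢v   = contradiction (u , u∈B , u≢v) none
    a≢v : a ≢ v
    a≢v refl = contradiction (trans (sym va) (proj₂ sg v)) λ ()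

  path⊆maximalClique : BlockGraph g → ∀ {v w} → v ∈ₛ B → w ∈ₛ B → v ≢ w →
                       (p : Walk g v w) → IsPath p → ∀ {z} → z ∈ verts p → z ∈ₛ B
  path⊆maximalClique blockGraph v∈B w∈B v≢w p p-path {z} z∈p =
    decidable-stable (B z ≟ᵇ true) λ z∉B →
      nonseparable⇒⊆block g S nonseparable (_ , ∈S⁺ˡ v∈B) λ (K , K-block , S⊆K) →
        z∉B (maximal K (blockGraph K K-block) (λ u → S⊆K u ∘ ∈S⁺ˡ) z
                     (S⊆K z (∈S⁺ʳ z∈p)))
    where open CliqueWithPath g-sym clique v∈B w∈B v≢w p p-path

another : ∀ {n} → 2 ≤ n → (v : Fin n) → ∃ λ o → v ≢ o
another {suc zero} (s≤s ()) _
another {suc (suc n)} _ zero    = suc zero , λ ()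
another {suc (suc n)} _ (suc v) = zero , λ ()

initColoring-black-leaf : ∀ {n} (g : Graph n) {v b} → initColoring g v ≡ just b → deg g v ≡ 1 × b ≡ true
initColoring-black-leaf g {v} init≡b with deg g v ≡ᵇ 1 in deg≡1
... | true = ≡ᵇ⇒≡ (deg g v) 1 (subst T (sym deg≡1) _) , sym (just-injective init≡b)

module Colouring {n : ℕ} {g : Graph n} (sg : SimpleGraph g) (n≥2 : 2 ≤ n) (blockGraph : BlockGraph g)
                 {t : Graph n} (spanning : SpanningTree g t) {c : Fin n → Bool} (admissible : Admissible t c) where

  private
    t⊆g = proj₁ (proj₂ spanning)
    t-connected = proj₁ (proj₂ (proj₂ spanning))
    proper = proj₁ admissible

  tree-walk : ∀ u v → Walk t u v
  tree-walk u v = proj₁ (t-connected u v refl refl)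

  tree-neighbour : ∀ v → ∃ λ a → t v a ≡ true
  tree-neighbour v = let o , v≢o = another n≥2 v
                         a , va , _ = successor (tree-walk v o) v≢o
                     in a , va

  leaf⇒tree-leaf : ∀ {v} → deg g v ≡ 1 → IsLeaf t v
  leaf⇒tree-leaf {v} deg≡1 = let a , va = tree-neighbour v in
    ≤-antisym (≤-trans (size-mono (t⊆g v)) (≤-reflexive deg≡1))
              (∈⇒0<size (t v) va)

  tree-neighbour-in-maximalClique : ∀ {B} → IsMaximalClique g B → ∀ {v u} → v ∈ₛ B → u ∈ₛ B → v ≢ u →
                                    ∃ λ s → t v s ≡ true × s ∈ₛ B
  tree-neighbour-in-maximalClique maxClique {v} {u} v∈B u∈B v≢u with toPath (tree-walk v u)
  ... | P , P-path with successor P v≢u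
  ...   | s , vs , s∈P = s , vs , path⊆maximalClique sg maxClique blockGraph v∈B u∈B v≢u (mapʷ t⊆g P)
                                    (subst Unique same-verts P-path) (subst (s ∈_) same-verts s∈P)
    where
    same-verts : verts P ≡ verts (mapʷ t⊆g P)
    same-verts = sym (verts-mapʷ t⊆g P)

  forced-colour : ∀ {B} → IsMaximalClique g B → ∀ {v} → v ∈ₛ B → ∀ col →
                  (∀ u → u ∈ₛ B → u ≢ v → c u ≡ col) → c v ≡ not col
  forced-colour {B} maxClique {v} v∈B col others = ¬-not λ cv≡col →
    let a , va = tree-neighbour v in
    maximalClique-nontrivial sg maxClique v∈B (t⊆g v a va) λ (u , u∈B , u≢v) →
      let s , vs , s∈B = tree-neighbour-in-maximalClique maxClique v∈B u∈B (u≢v ∘ sym) in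
      proper v s vs (trans cv≡col (sym (monochromatic cv≡col s s∈B)))
    where
    monochromatic : c v ≡ col → ∀ z → z ∈ₛ B → c z ≡ col
    monochromatic cv≡col z z∈B with z ≟ v
    ... | yes refl = cv≡col
    ... | no z≢v   = others z z∈B z≢v

  Agrees : PColoring → Set
  Agrees d = ∀ v b → d v ≡ just b → c v ≡ b

  agrees-init : Agrees (initColoring g)
  agrees-init v b init≡b = let deg≡1 , b≡true = initColoring-black-leaf g init≡b in
    trans (proj₂ admissible v (leaf⇒tree-leaf deg≡1)) (sym b≡true)

  agrees-step : ∀ {d d'} → Step g d d' → Agrees d → Agrees d'
  agrees-step (step B maxClique v v∈B _ col others d'v unchanged) agrees u b d'u≡b with u ≟ v
  ... | yes refl = trans (forced-colour maxClique v∈B col λ w w∈B w≢v → agrees w col (others w w∈B w≢v))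
                         (just-injective (trans (sym d'v) d'u≡b))
  ... | no u≢v   = agrees u b (trans (sym (unchanged u u≢v)) d'u≡b)

lemma12 : {n : ℕ} (g : Graph n) → SimpleGraph g → 3 ≤ n → Connected g → BlockGraph g →
    (c' : PColoring) → Star (Step g) (initColoring g) c' → Terminal g c' →
    (t : Graph n) → SpanningTree g t → EvenTree t →
    (c : Fin n → Bool) → Admissible t c →
    (v : Fin n) (b : Bool) → c' v ≡ just b → c v ≡ b
lemma12 g sg n≥3 _ blockGraph c' run _ t spanning _ c admissible =
  fold (λ d d' → Agrees d → Agrees d') (λ s k → k ∘ agrees-step s) id run agrees-init
  where open Colouring sg (<⇒≤ n≥3) blockGraph spanning admissible
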